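{- (i) Let $b$ be an integer and let $(h_n)_{n\ge 0}$ be an elliptic divisibility sequence with $h_0=0$, $h_1=1$, $h_2=0$, $h_3=-b^2$, $h_4=0$. Then for every odd positive integer $n$, \[h_n=\varepsilon\, b^{(n^2-1)/4},\qquad \varepsilon=\begin{cases}+1 & n\equiv 1,5 \pmod 8,\\ -1 & n\equiv 3,7\pmod 8.\end{cases}\] (ii) Let $a_3$ be an integer and let $(h_n)_{n\ge 0}$ be an elliptic divisibility sequence with $h_0=0$, $h_1=1$, $h_2=a_3$, $h_3=0$, $h_4=-a_3^5$. Then for every positive integer $n$ not divisible by $3$, \[h_n=\varepsilon\, a_3^{(n^2-1)/3},\qquad \varepsilon=\begin{cases}+1 & n\equiv 1,2 \pmod 6,\\ -1 & n\equiv 4,5\pmod 6.\end{cases}\]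
   Context: An elliptic divisibility sequence (EDS) is a sequence $(h_n)_{n\ge0}$ of integers satisfying $h_{m+n}h_{m-n}=h_{m+1}h_{m-1}h_n^2-h_{n+1}h_{n-1}h_m^2$ for all integers $m\ge n\ge 1$, and such that $h_n$ divides $h_m$ whenever $n$ divides $m$. -}

module Defs where

open import Data.Nat as ℕ using (ℕ; suc; _≤_; _∸_)
open import Data.Nat.Divisibility as ℕD using ()
open import Data.Integer as ℤ using (ℤ; +_; -_)
open import Data.Integer.Divisibility as ℤD using ()
open import Relation.Binary.PropositionalEquality using (_≡_)

record IsEDS (h : ℕ → ℤ) : Set where
  field
    recurrence : ∀ (m n : ℕ) → 1 ≤ n → n ≤ m →
      h (m ℕ.+ n) ℤ.* h (m ∸ n)
        ≡ h (suc m) ℤ.* h (m ∸ 1) ℤ.* (h n ℤ.* h n)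
          ℤ.- h (suc n) ℤ.* h (n ∸ 1) ℤ.* (h m ℤ.* h m)
    divisibility : ∀ (n m : ℕ) → n ℕD.∣ m → h n ℤD.∣ h m

ε₈ : ℕ → ℤ
ε₈ n with n ℕ.% 8
... | 3 = - (+ 1)
... | 7 = - (+ 1)
... | _ = + 1

ε₆ : ℕ → ℤ
ε₆ n with n ℕ.% 6
... | 4 = - (+ 1)
... | 5 = - (+ 1)
... | _ = + 1

module Submission where

-- In part (i) h₂ = 0 and in part (ii) h₃ = 0, so by the divisibility property h vanishes on
-- all multiples of 2, resp. 3.  The other values come from two duplication formulas of an EDS
-- (the recurrence at (m,n) = (k+2,k+1) and (k+3,k+1)):
--     h_{2k+3}       = h_{k+3} h_{k+1} h_{k+1}² − h_{k+2} h_k h_{k+2}²     (using h₁ = 1),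
--     h_{2k+4} · h₂  = h_{k+4} h_{k+2} h_{k+1}² − h_{k+2} h_k h_{k+3}².
-- In every instance needed, the squared factor of one of the two products is a vanishing
-- term, so h near index 2j is ± a product of values near index j.  The claimed values are
-- signed powers σ(p)·a^x with σ(p) = (−1)^p, which are closed under such products; the sign
-- parities and exponents are matched by the ring solver on ℕ.  Index 2i+2 needs the indices
-- i, i+1 and index 2i+3 needs i+1, i+2, so both parts go by a "halving induction".  In part
-- (ii) the even-index formula yields h_{2k+4}·a₃, and a₃ is cancelled (if a₃ = 0 both sides
-- vanish, as then h₂ = 0).  This gives
--   h_{2j+1} = σ(j)·b^{j(j+1)},  h_{3q+1} = σ(q)·a₃^{q(3q+2)},  h_{3q+2} = σ(q)·a₃^{(q+1)(3q+1)}.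

open import Defs
open import Data.Nat as ℕ using (ℕ; zero; suc; _∸_; _/_; _%_; _<_; s≤s)
open import Data.Nat.Divisibility as ℕD using ()
open import Data.Nat.Induction using (<-rec)
open import Data.Nat.Tactic.RingSolver using (solve)
open import Data.Integer as ℤ using (ℤ; +_; -_; _^_; +[1+_]; -[1+_])
open import Data.List using (_∷_; [])
open import Data.Product using (_×_; _,_; proj₁; proj₂; ∃-syntax)
open import Data.Sum using (_⊎_; inj₁; inj₂)
open import Data.Empty using (⊥-elim)
open import Relation.Binary.PropositionalEquality
  using (_≡_; _≢_; refl; sym; trans; cong; cong₂; subst; module ≡-Reasoning)
open import Relation.Nullary using (¬_)
import Data.Nat.Properties as ℕP
import Data.Nat.DivMod as ℕDM
import Data.Integer.Properties as ℤP
open import Algebra.Properties.CommutativeSemigroup ℤP.*-commutativeSemigroup using (interchange)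

open ≡-Reasoning

-- σ p = (−1)^p, defined so that σ (p + 2) reduces to σ p.
σ : ℕ → ℤ
σ zero          = + 1
σ (suc zero)    = - + 1
σ (suc (suc p)) = σ p

σ-suc : ∀ p → σ (suc p) ≡ - σ p
σ-suc zero          = refl
σ-suc (suc zero)    = refl
σ-suc (suc (suc p)) = σ-suc p

σ-+ : ∀ p q → σ (p ℕ.+ q) ≡ σ p ℤ.* σ q
σ-+ zero          q = sym (ℤP.*-identityˡ (σ q))
σ-+ (suc zero)    q = trans (σ-suc q) (sym (ℤP.-1*i≡-i (σ q)))
σ-+ (suc (suc p)) q = σ-+ p q

σ-double : ∀ k → σ (k ℕ.+ k) ≡ + 1
σ-double zero    = refl
σ-double (suc k) = trans (cong (λ m → σ (suc m)) (ℕP.+-suc k k)) (σ-double k)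

-- The signed power σ(p)·a^x, the shape of every value of h in the theorem.  It is opaque so
-- that Agda infers p and x from an occurrence of signedPow a p x in a goal.
opaque
  signedPow : ℤ → ℕ → ℕ → ℤ
  signedPow a p x = σ p ℤ.* a ^ x

opaque
  unfolding signedPow

  signedPow-unfold : ∀ {a p x} → signedPow a p x ≡ σ p ℤ.* a ^ x
  signedPow-unfold = refl

  signedPow-* : ∀ {a p x q y} →
    signedPow a p x ℤ.* signedPow a q y ≡ signedPow a (p ℕ.+ q) (x ℕ.+ y)
  signedPow-* {a} {p} {x} {q} {y} = begin
      σ p ℤ.* a ^ x ℤ.* (σ q ℤ.* a ^ y)
    ≡⟨ interchange (σ p) (a ^ x) (σ q) (a ^ y) ⟩
      σ p ℤ.* σ q ℤ.* (a ^ x ℤ.* a ^ y)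
    ≡⟨ cong₂ ℤ._*_ (σ-+ p q) (ℤP.^-distribˡ-+-* a x y) ⟨
      σ (p ℕ.+ q) ℤ.* a ^ (x ℕ.+ y)
    ∎

  signedPow-neg : ∀ {a p x} → - signedPow a p x ≡ signedPow a (suc p) x
  signedPow-neg {a} {p} {x} =
    trans (ℤP.neg-distribˡ-* (σ p) (a ^ x)) (cong (ℤ._* a ^ x) (sym (σ-suc p)))

  signedPow-*base : ∀ {a p x} → signedPow a p x ℤ.* a ≡ signedPow a p (suc x)
  signedPow-*base {a} {p} {x} =
    trans (ℤP.*-assoc (σ p) (a ^ x) a) (cong (σ p ℤ.*_) (ℤP.*-comm (a ^ x) a))

  -- Only the parity of the sign index matters.
  signedPow-reindex : ∀ {a p q x y} k → p ≡ k ℕ.+ k ℕ.+ q → x ≡ y →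
    signedPow a p x ≡ signedPow a q y
  signedPow-reindex {a} {q = q} {x} k refl refl = cong (ℤ._* a ^ x) (begin
    σ (k ℕ.+ k ℕ.+ q)        ≡⟨ σ-+ (k ℕ.+ k) q ⟩
    σ (k ℕ.+ k) ℤ.* σ q      ≡⟨ cong (ℤ._* σ q) (σ-double k) ⟩
    + 1 ℤ.* σ q              ≡⟨ ℤP.*-identityˡ (σ q) ⟩
    σ q                      ∎)

  signedPow-zero : ∀ {a p x} → a ≡ + 0 → signedPow a p (suc x) ≡ + 0
  signedPow-zero {p = p} refl = ℤP.*-zeroʳ (σ p)

signedPow-0 : ∀ {a x} → signedPow a 0 x ≡ a ^ x
signedPow-0 {a} {x} = trans signedPow-unfold (ℤP.*-identityˡ (a ^ x))

signedPow-1 : ∀ {a x} → signedPow a 1 x ≡ - a ^ x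
signedPow-1 {a} {x} = trans signedPow-unfold (ℤP.-1*i≡-i (a ^ x))

-- One of the two products h_{m+1} h_{m−1} h_n² in the EDS recurrence (opaque, so that its
-- three factors are inferred from goals).
opaque
  term : ℤ → ℤ → ℤ → ℤ
  term A B C = A ℤ.* B ℤ.* (C ℤ.* C)

term-cong : ∀ {A B C A′ B′ C′} → A ≡ A′ → B ≡ B′ → C ≡ C′ → term A B C ≡ term A′ B′ C′
term-cong refl refl refl = refl

opaque
  unfolding term

  recurrence-rhs : ∀ {A B C D E F} →
    A ℤ.* B ℤ.* (C ℤ.* C) ℤ.- D ℤ.* E ℤ.* (F ℤ.* F) ≡ term A B C ℤ.- term D E F
  recurrence-rhs = refl

  drop-second : ∀ {A B C D E F} → F ≡ + 0 → term A B C ℤ.- term D E F ≡ term A B C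
  drop-second {A} {B} {C} {D} {E} refl =
    trans (cong (λ t → term A B C ℤ.- t) (ℤP.*-zeroʳ (D ℤ.* E))) (ℤP.+-identityʳ (term A B C))

  drop-first : ∀ {A B C D E F} → C ≡ + 0 → term A B C ℤ.- term D E F ≡ - term D E F
  drop-first {A} {B} {D = D} {E} {F} refl =
    trans (cong (ℤ._- term D E F) (ℤP.*-zeroʳ (A ℤ.* B))) (ℤP.+-identityˡ (- term D E F))

  signedPow-term : ∀ {a p x q y r z} →
    term (signedPow a p x) (signedPow a q y) (signedPow a r z)
      ≡ signedPow a (p ℕ.+ q ℕ.+ (r ℕ.+ r)) (x ℕ.+ y ℕ.+ (z ℕ.+ z))
  signedPow-term = trans (cong₂ ℤ._*_ signedPow-* signedPow-*) signedPow-*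

term-signedPow : ∀ {a p x q y r z s w} k →
  p ℕ.+ q ℕ.+ (r ℕ.+ r) ≡ k ℕ.+ k ℕ.+ s → x ℕ.+ y ℕ.+ (z ℕ.+ z) ≡ w →
  term (signedPow a p x) (signedPow a q y) (signedPow a r z) ≡ signedPow a s w
term-signedPow k sign exponent = trans signedPow-term (signedPow-reindex k sign exponent)

neg-term-signedPow : ∀ {a p x q y r z s w} k →
  suc (p ℕ.+ q ℕ.+ (r ℕ.+ r)) ≡ k ℕ.+ k ℕ.+ s → x ℕ.+ y ℕ.+ (z ℕ.+ z) ≡ w →
  - term (signedPow a p x) (signedPow a q y) (signedPow a r z) ≡ signedPow a s w
neg-term-signedPow k sign exponent =
  trans (cong -_ signedPow-term) (trans signedPow-neg (signedPow-reindex k sign exponent))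

value-at : ∀ {A : Set} (f : ℕ → A) {m n c} → f n ≡ c → m ≡ n → f m ≡ c
value-at f fn≡c m≡n = trans (cong f m≡n) fn≡c

cancel-factor : ∀ a {x y} → x ℤ.* a ≡ y ℤ.* a → (a ≡ + 0 → x ≡ y) → x ≡ y
cancel-factor (+ zero)     _  degenerate = degenerate refl
cancel-factor a@(+[1+ _ ]) eq _          = ℤP.*-cancelʳ-≡ _ _ a eq
cancel-factor a@(-[1+ _ ]) eq _          = ℤP.*-cancelʳ-≡ _ _ a eq

data Halves : ℕ → Set where
  even : ∀ i → Halves (i ℕ.+ i)
  odd  : ∀ i → Halves (suc (i ℕ.+ i))

halves : ∀ n → Halves n
halves zero = even 0
halves (suc n) with halves n
... | even i = odd i
... | odd i  = subst Halves (cong suc (ℕP.+-suc i i)) (even (suc i))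

halving-induction : (P : ℕ → Set) → P 0 → P 1 →
  (∀ i → P i → P (suc i) → P (suc i ℕ.+ suc i)) →
  (∀ i → P (suc i) → P (suc (suc i)) → P (suc (suc i ℕ.+ suc i))) →
  ∀ n → P n
halving-induction P P0 P1 even-step odd-step = <-rec P step
  where
  step : ∀ n → (∀ {m} → m < n → P m) → P n
  step n below with halves n
  ... | even zero    = P0
  ... | odd zero     = P1
  ... | even (suc i) = even-step i (below (s≤s (ℕP.m≤m+n i (suc i))))
                                   (below (s≤s (ℕP.m≤n+m (suc i) i)))
  ... | odd (suc i)  = odd-step i (below (s≤s (s≤s (ℕP.m≤m+n i (suc i)))))
                                  (below (s≤s (s≤s (ℕP.m≤n+m (suc i) i))))

module EDS {h : ℕ → ℤ} (eds : IsEDS h) where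
  open IsEDS eds

  vanishes-on-multiples : ∀ {d n} → h d ≡ + 0 → d ℕD.∣ n → h n ≡ + 0
  vanishes-on-multiples {d} {n} hd≡0 d∣n = ℤP.∣i∣≡0⇒i≡0 (ℕD.0∣⇒≡0
    (subst (λ c → ℤ.∣ c ∣ ℕD.∣ ℤ.∣ h n ∣) hd≡0 (divisibility d n d∣n)))

  -- The recurrence at (m, n) = (k+2, k+1), normalised by h₁ = 1.
  odd-duplication : h 1 ≡ + 1 → ∀ k →
    h (suc (suc k ℕ.+ suc k))
      ≡ term (h (3 ℕ.+ k)) (h (1 ℕ.+ k)) (h (1 ℕ.+ k)) ℤ.- term (h (2 ℕ.+ k)) (h k) (h (2 ℕ.+ k))
  odd-duplication h₁≡1 k = begin
      h (suc (suc k ℕ.+ suc k))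
    ≡⟨ ℤP.*-identityʳ _ ⟨
      h (suc (suc k ℕ.+ suc k)) ℤ.* + 1
    ≡⟨ cong (h (suc (suc k ℕ.+ suc k)) ℤ.*_) (sym (value-at h h₁≡1 (ℕP.m+n∸n≡m 1 k))) ⟩
      h (suc (suc k ℕ.+ suc k)) ℤ.* h (suc k ∸ k)
    ≡⟨ recurrence (suc (suc k)) (suc k) (s≤s ℕ.z≤n) (ℕP.n≤1+n _) ⟩
      _
    ≡⟨ recurrence-rhs ⟩
      _
    ∎

  -- The recurrence at (m, n) = (k+3, k+1).
  even-duplication : ∀ k →
    h (suc (suc k) ℕ.+ suc (suc k)) ℤ.* h 2
      ≡ term (h (4 ℕ.+ k)) (h (2 ℕ.+ k)) (h (1 ℕ.+ k)) ℤ.- term (h (2 ℕ.+ k)) (h k) (h (3 ℕ.+ k))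
  even-duplication k = begin
      h (suc (suc k) ℕ.+ suc (suc k)) ℤ.* h 2
    ≡⟨ cong₂ ℤ._*_ (cong h (solve (k ∷ []))) (cong h (sym (ℕP.m+n∸n≡m 2 k))) ⟩
      h (suc (suc (suc k)) ℕ.+ suc k) ℤ.* h (suc (suc k) ∸ k)
    ≡⟨ recurrence (suc (suc (suc k))) (suc k) (s≤s ℕ.z≤n) (ℕP.m≤n+m _ 2) ⟩
      _
    ≡⟨ recurrence-rhs ⟩
      _
    ∎

module PartI (b : ℤ) {h : ℕ → ℤ} (eds : IsEDS h)
             (h₁≡1 : h 1 ≡ + 1) (h₂≡0 : h 2 ≡ + 0) (h₃≡-b² : h 3 ≡ - (b ^ 2)) where
  open EDS eds

  S : ℕ → ℤ
  S j = signedPow b j (j ℕ.* suc j)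

  OddValue : ℕ → Set
  OddValue j = h (suc (j ℕ.+ j)) ≡ S j

  even-vanishes : ∀ {n} m → n ≡ m ℕ.* 2 → h n ≡ + 0
  even-vanishes m n≡2m = vanishes-on-multiples h₂≡0 (ℕD.divides m n≡2m)

  -- h_{4i+5} = −h_{2i+3} h_{2i+1} h_{2i+3}², since h_{2i+2} = 0.
  odd-value-even : ∀ i → OddValue i → OddValue (suc i) → OddValue (suc i ℕ.+ suc i)
  odd-value-even i hᵢ hᵢ₊₁ = begin
      h (suc ((suc i ℕ.+ suc i) ℕ.+ (suc i ℕ.+ suc i)))
    ≡⟨ odd-duplication h₁≡1 (i ℕ.+ suc i) ⟩
      term (h (3 ℕ.+ (i ℕ.+ suc i))) (h (1 ℕ.+ (i ℕ.+ suc i))) (h (1 ℕ.+ (i ℕ.+ suc i)))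
        ℤ.- term (h (2 ℕ.+ (i ℕ.+ suc i))) (h (i ℕ.+ suc i)) (h (2 ℕ.+ (i ℕ.+ suc i)))
    ≡⟨ drop-first (even-vanishes (suc i) (solve (i ∷ []))) ⟩
      - term (h (2 ℕ.+ (i ℕ.+ suc i))) (h (i ℕ.+ suc i)) (h (2 ℕ.+ (i ℕ.+ suc i)))
    ≡⟨ cong -_ (term-cong hᵢ₊₁ (value-at h hᵢ (ℕP.+-suc i i)) hᵢ₊₁) ⟩
      - term (S (suc i)) (S i) (S (suc i))
    ≡⟨ neg-term-signedPow (suc i) (solve (i ∷ [])) (solve (i ∷ [])) ⟩
      S (suc i ℕ.+ suc i)
    ∎

  -- h_{4i+7} = h_{2i+5} h_{2i+3} h_{2i+3}², since h_{2i+4} = 0.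
  odd-value-odd : ∀ i → OddValue (suc i) → OddValue (suc (suc i)) → OddValue (suc (suc i ℕ.+ suc i))
  odd-value-odd i hᵢ₊₁ hᵢ₊₂ = begin
      h (suc ((suc (suc i ℕ.+ suc i)) ℕ.+ (suc (suc i ℕ.+ suc i))))
    ≡⟨ odd-duplication h₁≡1 (suc i ℕ.+ suc i) ⟩
      term (h (3 ℕ.+ (suc i ℕ.+ suc i))) (h (1 ℕ.+ (suc i ℕ.+ suc i))) (h (1 ℕ.+ (suc i ℕ.+ suc i)))
        ℤ.- term (h (2 ℕ.+ (suc i ℕ.+ suc i))) (h (suc i ℕ.+ suc i)) (h (2 ℕ.+ (suc i ℕ.+ suc i)))
    ≡⟨ drop-second (even-vanishes (suc (suc i)) (solve (i ∷ []))) ⟩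
      term (h (3 ℕ.+ (suc i ℕ.+ suc i))) (h (1 ℕ.+ (suc i ℕ.+ suc i))) (h (1 ℕ.+ (suc i ℕ.+ suc i)))
    ≡⟨ term-cong (value-at h hᵢ₊₂ (solve (i ∷ []))) hᵢ₊₁ hᵢ₊₁ ⟩
      term (S (suc (suc i))) (S (suc i)) (S (suc i))
    ≡⟨ term-signedPow (suc i) (solve (i ∷ [])) (solve (i ∷ [])) ⟩
      S (suc (suc i ℕ.+ suc i))
    ∎

  odd-values : ∀ j → OddValue j
  odd-values = halving-induction OddValue
    (trans h₁≡1 (sym signedPow-0)) (trans h₃≡-b² (sym signedPow-1))
    odd-value-even odd-value-odd

module PartII (a : ℤ) {h : ℕ → ℤ} (eds : IsEDS h) (h₁≡1 : h 1 ≡ + 1) (h₂≡a : h 2 ≡ a)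
              (h₃≡0 : h 3 ≡ + 0) (h₄≡-a⁵ : h 4 ≡ - (a ^ 5)) where
  open EDS eds

  U V : ℕ → ℤ
  U j = signedPow a j (j ℕ.* (2 ℕ.+ 3 ℕ.* j))
  V j = signedPow a j ((1 ℕ.+ j) ℕ.* (1 ℕ.+ 3 ℕ.* j))

  Values : ℕ → Set
  Values j = (h (1 ℕ.+ 3 ℕ.* j) ≡ U j) × (h (2 ℕ.+ 3 ℕ.* j) ≡ V j)

  triple-vanishes : ∀ {n} m → n ≡ m ℕ.* 3 → h n ≡ + 0
  triple-vanishes m n≡3m = vanishes-on-multiples h₃≡0 (ℕD.divides m n≡3m)

  even-vanishes : a ≡ + 0 → ∀ {n} m → n ≡ m ℕ.* 2 → h n ≡ + 0
  even-vanishes a≡0 m n≡2m = vanishes-on-multiples (trans h₂≡a a≡0) (ℕD.divides m n≡2m)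

  -- h_{6i+5} = h_{3i+4} h_{3i+2} h_{3i+2}², since h_{3i+3} = 0.
  v-odd : ∀ i → h (1 ℕ.+ 3 ℕ.* suc i) ≡ U (suc i) → h (2 ℕ.+ 3 ℕ.* i) ≡ V i →
          h (2 ℕ.+ 3 ℕ.* suc (i ℕ.+ i)) ≡ V (suc (i ℕ.+ i))
  v-odd i uᵢ₊₁ vᵢ = value-at h (begin
      h (1 ℕ.+ ((2 ℕ.+ 3 ℕ.* i) ℕ.+ (2 ℕ.+ 3 ℕ.* i)))
    ≡⟨ odd-duplication h₁≡1 (1 ℕ.+ 3 ℕ.* i) ⟩
      term (h (4 ℕ.+ 3 ℕ.* i)) (h (2 ℕ.+ 3 ℕ.* i)) (h (2 ℕ.+ 3 ℕ.* i))
        ℤ.- term (h (3 ℕ.+ 3 ℕ.* i)) (h (1 ℕ.+ 3 ℕ.* i)) (h (3 ℕ.+ 3 ℕ.* i))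
    ≡⟨ drop-second (triple-vanishes (suc i) (solve (i ∷ []))) ⟩
      term (h (4 ℕ.+ 3 ℕ.* i)) (h (2 ℕ.+ 3 ℕ.* i)) (h (2 ℕ.+ 3 ℕ.* i))
    ≡⟨ term-cong (value-at h uᵢ₊₁ (solve (i ∷ []))) vᵢ vᵢ ⟩
      term (U (suc i)) (V i) (V i)
    ≡⟨ term-signedPow i (solve (i ∷ [])) (solve (i ∷ [])) ⟩
      V (suc (i ℕ.+ i))
    ∎) (solve (i ∷ []))

  -- h_{6i+4} a = h_{3i+4} h_{3i+2} h_{3i+1}², since h_{3i+3} = 0.
  u-odd : ∀ i → h (1 ℕ.+ 3 ℕ.* suc i) ≡ U (suc i) → h (2 ℕ.+ 3 ℕ.* i) ≡ V i →
          h (1 ℕ.+ 3 ℕ.* i) ≡ U i → h (1 ℕ.+ 3 ℕ.* suc (i ℕ.+ i)) ≡ U (suc (i ℕ.+ i))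
  u-odd i uᵢ₊₁ vᵢ uᵢ = cancel-factor a times-a degenerate
    where
    times-a : h (1 ℕ.+ 3 ℕ.* suc (i ℕ.+ i)) ℤ.* a ≡ U (suc (i ℕ.+ i)) ℤ.* a
    times-a = begin
        h (1 ℕ.+ 3 ℕ.* suc (i ℕ.+ i)) ℤ.* a
      ≡⟨ cong₂ ℤ._*_ (cong h (solve (i ∷ []))) (sym h₂≡a) ⟩
        h ((2 ℕ.+ 3 ℕ.* i) ℕ.+ (2 ℕ.+ 3 ℕ.* i)) ℤ.* h 2
      ≡⟨ even-duplication (3 ℕ.* i) ⟩
        term (h (4 ℕ.+ 3 ℕ.* i)) (h (2 ℕ.+ 3 ℕ.* i)) (h (1 ℕ.+ 3 ℕ.* i))
          ℤ.- term (h (2 ℕ.+ 3 ℕ.* i)) (h (3 ℕ.* i)) (h (3 ℕ.+ 3 ℕ.* i))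
      ≡⟨ drop-second (triple-vanishes (suc i) (solve (i ∷ []))) ⟩
        term (h (4 ℕ.+ 3 ℕ.* i)) (h (2 ℕ.+ 3 ℕ.* i)) (h (1 ℕ.+ 3 ℕ.* i))
      ≡⟨ term-cong (value-at h uᵢ₊₁ (solve (i ∷ []))) vᵢ uᵢ ⟩
        term (U (suc i)) (V i) (U i)
      ≡⟨ term-signedPow i (solve (i ∷ [])) (solve (i ∷ [])) ⟩
        signedPow a (suc (i ℕ.+ i)) (suc (suc (i ℕ.+ i) ℕ.* (2 ℕ.+ 3 ℕ.* suc (i ℕ.+ i))))
      ≡⟨ signedPow-*base ⟨
        U (suc (i ℕ.+ i)) ℤ.* a
      ∎
    degenerate : a ≡ + 0 → h (1 ℕ.+ 3 ℕ.* suc (i ℕ.+ i)) ≡ U (suc (i ℕ.+ i))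
    degenerate a≡0 =
      trans (even-vanishes a≡0 (2 ℕ.+ 3 ℕ.* i) (solve (i ∷ []))) (sym (signedPow-zero a≡0))

  -- h_{6i+7} = −h_{3i+4} h_{3i+2} h_{3i+4}², since h_{3i+3} = 0.
  u-even : ∀ i → h (1 ℕ.+ 3 ℕ.* suc i) ≡ U (suc i) → h (2 ℕ.+ 3 ℕ.* i) ≡ V i →
           h (1 ℕ.+ 3 ℕ.* (suc i ℕ.+ suc i)) ≡ U (suc i ℕ.+ suc i)
  u-even i uᵢ₊₁ vᵢ = value-at h (begin
      h (1 ℕ.+ ((3 ℕ.+ 3 ℕ.* i) ℕ.+ (3 ℕ.+ 3 ℕ.* i)))
    ≡⟨ odd-duplication h₁≡1 (2 ℕ.+ 3 ℕ.* i) ⟩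
      term (h (5 ℕ.+ 3 ℕ.* i)) (h (3 ℕ.+ 3 ℕ.* i)) (h (3 ℕ.+ 3 ℕ.* i))
        ℤ.- term (h (4 ℕ.+ 3 ℕ.* i)) (h (2 ℕ.+ 3 ℕ.* i)) (h (4 ℕ.+ 3 ℕ.* i))
    ≡⟨ drop-first (triple-vanishes (suc i) (solve (i ∷ []))) ⟩
      - term (h (4 ℕ.+ 3 ℕ.* i)) (h (2 ℕ.+ 3 ℕ.* i)) (h (4 ℕ.+ 3 ℕ.* i))
    ≡⟨ cong -_ (term-cong (value-at h uᵢ₊₁ (solve (i ∷ []))) vᵢ
                          (value-at h uᵢ₊₁ (solve (i ∷ [])))) ⟩
      - term (U (suc i)) (V i) (U (suc i))
    ≡⟨ neg-term-signedPow (suc i) (solve (i ∷ [])) (solve (i ∷ [])) ⟩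
      U (suc i ℕ.+ suc i)
    ∎) (solve (i ∷ []))

  -- h_{6i+8} a = −h_{3i+4} h_{3i+2} h_{3i+5}², since h_{3i+3} = 0.
  v-even : ∀ i → h (1 ℕ.+ 3 ℕ.* suc i) ≡ U (suc i) → h (2 ℕ.+ 3 ℕ.* i) ≡ V i →
           h (2 ℕ.+ 3 ℕ.* suc i) ≡ V (suc i) →
           h (2 ℕ.+ 3 ℕ.* (suc i ℕ.+ suc i)) ≡ V (suc i ℕ.+ suc i)
  v-even i uᵢ₊₁ vᵢ vᵢ₊₁ = cancel-factor a times-a degenerate
    where
    times-a : h (2 ℕ.+ 3 ℕ.* (suc i ℕ.+ suc i)) ℤ.* a ≡ V (suc i ℕ.+ suc i) ℤ.* a
    times-a = begin
        h (2 ℕ.+ 3 ℕ.* (suc i ℕ.+ suc i)) ℤ.* a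
      ≡⟨ cong₂ ℤ._*_ (cong h (solve (i ∷ []))) (sym h₂≡a) ⟩
        h ((4 ℕ.+ 3 ℕ.* i) ℕ.+ (4 ℕ.+ 3 ℕ.* i)) ℤ.* h 2
      ≡⟨ even-duplication (2 ℕ.+ 3 ℕ.* i) ⟩
        term (h (6 ℕ.+ 3 ℕ.* i)) (h (4 ℕ.+ 3 ℕ.* i)) (h (3 ℕ.+ 3 ℕ.* i))
          ℤ.- term (h (4 ℕ.+ 3 ℕ.* i)) (h (2 ℕ.+ 3 ℕ.* i)) (h (5 ℕ.+ 3 ℕ.* i))
      ≡⟨ drop-first (triple-vanishes (suc i) (solve (i ∷ []))) ⟩
        - term (h (4 ℕ.+ 3 ℕ.* i)) (h (2 ℕ.+ 3 ℕ.* i)) (h (5 ℕ.+ 3 ℕ.* i))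
      ≡⟨ cong -_ (term-cong (value-at h uᵢ₊₁ (solve (i ∷ []))) vᵢ
                            (value-at h vᵢ₊₁ (solve (i ∷ [])))) ⟩
        - term (U (suc i)) (V i) (V (suc i))
      ≡⟨ neg-term-signedPow (suc i) (solve (i ∷ [])) (solve (i ∷ [])) ⟩
        signedPow a (suc i ℕ.+ suc i)
                    (suc ((1 ℕ.+ (suc i ℕ.+ suc i)) ℕ.* (1 ℕ.+ 3 ℕ.* (suc i ℕ.+ suc i))))
      ≡⟨ signedPow-*base ⟨
        V (suc i ℕ.+ suc i) ℤ.* a
      ∎
    degenerate : a ≡ + 0 → h (2 ℕ.+ 3 ℕ.* (suc i ℕ.+ suc i)) ≡ V (suc i ℕ.+ suc i)
    degenerate a≡0 =
      trans (even-vanishes a≡0 (4 ℕ.+ 3 ℕ.* i) (solve (i ∷ []))) (sym (signedPow-zero a≡0))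

  values : ∀ j → Values j
  values = halving-induction Values (h₁≡U₀ , h₂≡V₀) (h₄≡U₁ , v-odd 0 h₄≡U₁ h₂≡V₀)
    (λ i (_ , vᵢ) (uᵢ₊₁ , vᵢ₊₁) → u-even i uᵢ₊₁ vᵢ , v-even i uᵢ₊₁ vᵢ vᵢ₊₁)
    (λ i (uᵢ₊₁ , vᵢ₊₁) (uᵢ₊₂ , _) → u-odd (suc i) uᵢ₊₂ vᵢ₊₁ uᵢ₊₁ , v-odd (suc i) uᵢ₊₂ vᵢ₊₁)
    where
    h₁≡U₀ : h 1 ≡ U 0
    h₁≡U₀ = trans h₁≡1 (sym signedPow-0)
    h₂≡V₀ : h 2 ≡ V 0
    h₂≡V₀ = trans h₂≡a (sym (trans signedPow-0 (ℤP.*-identityʳ a)))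
    h₄≡U₁ : h 4 ≡ U 1
    h₄≡U₁ = trans h₄≡-a⁵ (sym signedPow-1)

ε₈-shift : ∀ m n → m ≡ n ℕ.+ 8 → ε₈ m ≡ ε₈ n
ε₈-shift _ n refl rewrite ℕDM.[m+n]%n≡m%n n 8 ⦃ ℕ.nonZero ⦄ = refl

ε₆-shift : ∀ m n → m ≡ n ℕ.+ 6 → ε₆ m ≡ ε₆ n
ε₆-shift _ n refl rewrite ℕDM.[m+n]%n≡m%n n 6 ⦃ ℕ.nonZero ⦄ = refl

ε₈-odd : ∀ j → ε₈ (suc (j ℕ.+ j)) ≡ σ j
ε₈-odd 0 = refl
ε₈-odd 1 = refl
ε₈-odd 2 = refl
ε₈-odd 3 = refl
ε₈-odd (suc (suc (suc (suc j)))) =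
  trans (ε₈-shift (5 ℕ.+ j ℕ.+ (4 ℕ.+ j)) (suc (j ℕ.+ j)) (solve (j ∷ []))) (ε₈-odd j)

ε₆-one : ∀ q → ε₆ (suc (3 ℕ.* q)) ≡ σ q
ε₆-one 0 = refl
ε₆-one 1 = refl
ε₆-one (suc (suc q)) =
  trans (ε₆-shift (suc (3 ℕ.* suc (suc q))) (suc (3 ℕ.* q)) (solve (q ∷ []))) (ε₆-one q)

ε₆-two : ∀ q → ε₆ (suc (suc (3 ℕ.* q))) ≡ σ q
ε₆-two 0 = refl
ε₆-two 1 = refl
ε₆-two (suc (suc q)) =
  trans (ε₆-shift (suc (suc (3 ℕ.* suc (suc q)))) (suc (suc (3 ℕ.* q))) (solve (q ∷ []))) (ε₆-two q)

-- The exponents (n² − 1)/d of the statement, computed on the relevant residue classes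
-- (n² − 1 is stated in its normal form, e.g. (2j+1)² ∸ 1 reduces to 2j + 2j(2j+1)).
exponent-of : ∀ d .{{_ : ℕ.NonZero d}} n e → n ℕ.* n ∸ 1 ≡ e ℕ.* d → (n ℕ.* n ∸ 1) / d ≡ e
exponent-of d n e eq = trans (cong (_/ d) eq) (ℕDM.m*n/n≡m e d)

odd-exponent : ∀ j → (suc (j ℕ.+ j) ℕ.* suc (j ℕ.+ j) ∸ 1) / 4 ≡ j ℕ.* suc j
odd-exponent j = exponent-of 4 (suc (j ℕ.+ j)) (j ℕ.* suc j) square-minus-one
  where
  square-minus-one : j ℕ.+ j ℕ.+ (j ℕ.+ j) ℕ.* suc (j ℕ.+ j) ≡ j ℕ.* suc j ℕ.* 4
  square-minus-one = solve (j ∷ [])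

one-mod-3-exponent : ∀ q → (suc (3 ℕ.* q) ℕ.* suc (3 ℕ.* q) ∸ 1) / 3 ≡ q ℕ.* suc (suc (3 ℕ.* q))
one-mod-3-exponent q = exponent-of 3 (suc (3 ℕ.* q)) (q ℕ.* suc (suc (3 ℕ.* q))) square-minus-one
  where
  square-minus-one : 3 ℕ.* q ℕ.+ 3 ℕ.* q ℕ.* suc (3 ℕ.* q) ≡ q ℕ.* suc (suc (3 ℕ.* q)) ℕ.* 3
  square-minus-one = solve (q ∷ [])

two-mod-3-exponent : ∀ q → (suc (suc (3 ℕ.* q)) ℕ.* suc (suc (3 ℕ.* q)) ∸ 1) / 3 ≡ suc q ℕ.* suc (3 ℕ.* q)
two-mod-3-exponent q = exponent-of 3 (suc (suc (3 ℕ.* q))) (suc q ℕ.* suc (3 ℕ.* q)) square-minus-one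
  where
  square-minus-one : suc (3 ℕ.* q) ℕ.+ suc (3 ℕ.* q) ℕ.* suc (suc (3 ℕ.* q)) ≡ suc q ℕ.* suc (3 ℕ.* q) ℕ.* 3
  square-minus-one = solve (q ∷ [])

odd-form : ∀ {n} → n % 2 ≡ 1 → n ≡ suc (n / 2 ℕ.+ n / 2)
odd-form {n} n-odd = begin
  n                        ≡⟨ ℕDM.m≡m%n+[m/n]*n n 2 ⟩
  n % 2 ℕ.+ n / 2 ℕ.* 2    ≡⟨ cong (ℕ._+ n / 2 ℕ.* 2) n-odd ⟩
  1 ℕ.+ n / 2 ℕ.* 2        ≡⟨ double-plus-one (n / 2) ⟩
  suc (n / 2 ℕ.+ n / 2)    ∎
  where
  double-plus-one : ∀ q → 1 ℕ.+ q ℕ.* 2 ≡ suc (q ℕ.+ q)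
  double-plus-one q = solve (q ∷ [])

prime-to-3-form : ∀ {n} → ¬ (3 ℕD.∣ n) →
  (∃[ q ] n ≡ suc (3 ℕ.* q)) ⊎ (∃[ q ] n ≡ suc (suc (3 ℕ.* q)))
prime-to-3-form {n} 3∤n = by-residue (n % 3) (n / 3) (ℕDM.m≡m%n+[m/n]*n n 3) (ℕDM.m%n<n n 3)
  where
  by-residue : ∀ r q → n ≡ r ℕ.+ q ℕ.* 3 → r < 3 →
    (∃[ q ] n ≡ suc (3 ℕ.* q)) ⊎ (∃[ q ] n ≡ suc (suc (3 ℕ.* q)))
  by-residue 0 q eq _ = ⊥-elim (3∤n (ℕD.divides q eq))
  by-residue 1 q eq _ = inj₁ (q , trans eq (solve (q ∷ [])))
  by-residue 2 q eq _ = inj₂ (q , trans eq (solve (q ∷ [])))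
  by-residue (suc (suc (suc _))) _ _ (s≤s (s≤s (s≤s ())))

part-i-at : ∀ (b : ℤ) {h : ℕ → ℤ} → IsEDS h → h 1 ≡ + 1 → h 2 ≡ + 0 → h 3 ≡ - (b ^ 2) →
  ∀ {n} j → n ≡ suc (j ℕ.+ j) → h n ≡ ε₈ n ℤ.* b ^ ((n ℕ.* n ∸ 1) / 4)
part-i-at b {h} eds h₁≡1 h₂≡0 h₃≡-b² j refl = begin
    h n′
  ≡⟨ PartI.odd-values b eds h₁≡1 h₂≡0 h₃≡-b² j ⟩
    signedPow b j (j ℕ.* suc j)
  ≡⟨ signedPow-unfold ⟩
    σ j ℤ.* b ^ (j ℕ.* suc j)
  ≡⟨ cong₂ ℤ._*_ (ε₈-odd j) (cong (b ^_) (odd-exponent j)) ⟨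
    ε₈ n′ ℤ.* b ^ ((n′ ℕ.* n′ ∸ 1) / 4)
  ∎
  where
  n′ : ℕ
  n′ = suc (j ℕ.+ j)

part-ii-at : ∀ (a : ℤ) {h : ℕ → ℤ} → IsEDS h →
  h 1 ≡ + 1 → h 2 ≡ a → h 3 ≡ + 0 → h 4 ≡ - (a ^ 5) →
  ∀ {n} → (∃[ q ] n ≡ suc (3 ℕ.* q)) ⊎ (∃[ q ] n ≡ suc (suc (3 ℕ.* q))) →
  h n ≡ ε₆ n ℤ.* a ^ ((n ℕ.* n ∸ 1) / 3)
part-ii-at a {h} eds h₁≡1 h₂≡a h₃≡0 h₄≡-a⁵ (inj₁ (q , refl)) = begin
    h n′
  ≡⟨ proj₁ (values q) ⟩
    signedPow a q (q ℕ.* (2 ℕ.+ 3 ℕ.* q))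
  ≡⟨ signedPow-unfold ⟩
    σ q ℤ.* a ^ (q ℕ.* (2 ℕ.+ 3 ℕ.* q))
  ≡⟨ cong₂ ℤ._*_ (ε₆-one q) (cong (a ^_) (one-mod-3-exponent q)) ⟨
    ε₆ n′ ℤ.* a ^ ((n′ ℕ.* n′ ∸ 1) / 3)
  ∎
  where
  open PartII a eds h₁≡1 h₂≡a h₃≡0 h₄≡-a⁵
  n′ : ℕ
  n′ = 1 ℕ.+ 3 ℕ.* q
part-ii-at a {h} eds h₁≡1 h₂≡a h₃≡0 h₄≡-a⁵ (inj₂ (q , refl)) = begin
    h n′
  ≡⟨ proj₂ (values q) ⟩
    signedPow a q ((1 ℕ.+ q) ℕ.* (1 ℕ.+ 3 ℕ.* q))
  ≡⟨ signedPow-unfold ⟩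
    σ q ℤ.* a ^ ((1 ℕ.+ q) ℕ.* (1 ℕ.+ 3 ℕ.* q))
  ≡⟨ cong₂ ℤ._*_ (ε₆-two q) (cong (a ^_) (two-mod-3-exponent q)) ⟨
    ε₆ n′ ℤ.* a ^ ((n′ ℕ.* n′ ∸ 1) / 3)
  ∎
  where
  open PartII a eds h₁≡1 h₂≡a h₃≡0 h₄≡-a⁵
  n′ : ℕ
  n′ = 2 ℕ.+ 3 ℕ.* q

theorem3p3 :
    (∀ (b : ℤ) (h : ℕ → ℤ) → IsEDS h →
        h 0 ≡ + 0 → h 1 ≡ + 1 → h 2 ≡ + 0 → h 3 ≡ - (b ^ 2) → h 4 ≡ + 0 →
        ∀ (n : ℕ) → n % 2 ≡ 1 →
        h n ≡ ε₈ n ℤ.* b ^ ((n ℕ.* n ∸ 1) / 4))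
    ×
    (∀ (a₃ : ℤ) (h : ℕ → ℤ) → IsEDS h →
        h 0 ≡ + 0 → h 1 ≡ + 1 → h 2 ≡ a₃ → h 3 ≡ + 0 → h 4 ≡ - (a₃ ^ 5) →
        ∀ (n : ℕ) → n ≢ 0 → ¬ (3 ℕD.∣ n) →
        h n ≡ ε₆ n ℤ.* a₃ ^ ((n ℕ.* n ∸ 1) / 3))
theorem3p3 =
  (λ b h eds _ h₁≡1 h₂≡0 h₃≡-b² _ n n-odd →
     part-i-at b eds h₁≡1 h₂≡0 h₃≡-b² (n / 2) (odd-form n-odd)) ,
  -- An n prime to 3 is 3q+1 or 3q+2 (which also excludes n = 0).
  (λ a₃ h eds _ h₁≡1 h₂≡a₃ h₃≡0 h₄≡-a₃⁵ n _ 3∤n →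
     part-ii-at a₃ eds h₁≡1 h₂≡a₃ h₃≡0 h₄≡-a₃⁵ (prime-to-3-form 3∤n))
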